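{- Let $n>2$ be even and $t$ a positive integer. Given a magic labelling of sum $t$ of the grid graph $\mathcal{G}(3,n)$, for $1\le i\le n-1$ let $a_i$, $b_i$, $c_i$ denote the labels of the $i$-th horizontal edge (counted from the left) in the top, middle and bottom rows, respectively. Then $c_i=b_i-a_i$ for $i$ even and $c_i=t-a_i+b_i$ for $i$ odd.
   Context: The grid graph $\mathcal{G}(3,n)$ has vertex set $\{(i,j)\in\mathbf{Z}^2: 0\le i<n,\ 0\le j<3\}$, with $(i,j),(i',j')$ adjacent iff $|i-i'|+|j-j'|=1$; it consists of three rows of $n$ vertices, each row containing $n-1$ horizontal edges $\{(i-1,j),(i,j)\}$, $1\le i\le n-1$ (the $i$-th edge of that row). A magic labelling of sum $t$ is a function $E\to\mathbf{Z}_{\ge0}$ such that at each vertex the labels of incident edges sum to $t$. -}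

module Defs where

open import Data.Nat using (ℕ; zero; suc; _∸_; _<?_)
open import Data.Fin using (Fin; toℕ; fromℕ<) renaming (zero to f0; suc to fs)
open import Data.List using (List; []; _∷_; _++_; map)
open import Data.Nat.ListAction using (sum)
open import Relation.Nullary using (yes; no)
open import Relation.Binary.PropositionalEquality using (_≡_)

-- Vertices of G(3,n): pairs (i , j) with i : Fin n (column), j : Fin 3 (row).
-- Edges of G(3,n):
--   hor j k : horizontal edge {(k , j) , (k+1 , j)} in row j, k : Fin (n ∸ 1);
--             this is the (k+1)-th edge of row j in the paper's 1-based count.
--   ver j i : vertical edge {(i , j) , (i , j+1)}, j : Fin 2, i : Fin n.
data Edge (n : ℕ) : Set where
  hor : Fin 3 → Fin (n ∸ 1) → Edge n
  ver : Fin 2 → Fin n → Edge n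

horAt : (n : ℕ) → Fin 3 → ℕ → List (Edge n)
horAt n j k with k <? n ∸ 1
... | yes p = hor j (fromℕ< p) ∷ []
... | no _  = []

verAt : (n : ℕ) → Fin n → Fin 3 → List (Edge n)
verAt n i f0           = ver f0 i ∷ []
verAt n i (fs f0)      = ver f0 i ∷ ver (fs f0) i ∷ []
verAt n i (fs (fs f0)) = ver (fs f0) i ∷ []

horIncident : (n : ℕ) → ℕ → Fin 3 → List (Edge n)
horIncident n zero    j = horAt n j zero
horIncident n (suc m) j = horAt n j m ++ horAt n j (suc m)

incident : (n : ℕ) → Fin n → Fin 3 → List (Edge n)
incident n i j = horIncident n (toℕ i) j ++ verAt n i j

IsMagic : (n : ℕ) → (Edge n → ℕ) → ℕ → Set
IsMagic n f t = (i : Fin n) (j : Fin 3) → sum (map f (incident n i j)) ≡ t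

-- Call a + c − b the defect of a column of horizontal edges (labels a, b, c in the
-- top, middle and bottom row).  Adding the vertex conditions at the top and bottom
-- vertex of a column of vertices and subtracting the one at the middle vertex
-- cancels both vertical edges, because the middle vertex meets both of them: the
-- defects of the horizontal edges on the two sides of every column of vertices
-- add up to t.  The leftmost column has no edges on its left, so the defects
-- alternate t, 0, t, 0, … from the left, which is the claim solved for c.
module Submission where

open import Defs
open import Data.Nat using (ℕ; suc; _<_; _∸_)
open import Data.Nat.Divisibility using (_∣_)
open import Data.Fin using (Fin; toℕ) renaming (zero to f0; suc to fs)
open import Data.Integer using (ℤ; +_; _-_) renaming (_+_ to _+ℤ_)
open import Data.Product using (_×_)
open import Relation.Nullary using (¬_)
open import Relation.Binary.PropositionalEquality using (_≡_)

open import Data.Nat using (zero; _+_; _<?_)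
open import Data.Nat.Properties using (+-identityʳ; <⇒≤; <-trans; n<1+n; <-≤-trans; m∸n≤m)
open import Data.Nat.Divisibility using (∣-refl; ∣m∣n⇒∣m+n; ∣m+n∣m⇒∣n; ∣1⇒≡1)
open import Data.Nat.ListAction using (sum)
open import Data.Nat.ListAction.Properties using (sum-++)
open import Data.List using ([]; _∷_; _++_; map)
open import Data.List.Properties using (map-++)
open import Data.Integer using (0ℤ)
open import Data.Integer.Properties using (pos-+; +-identityˡ; +-inverseʳ; +-comm)
open import Data.Integer.Tactic.RingSolver using (solve)
open import Data.Fin using (fromℕ<)
open import Data.Fin.Properties using (toℕ-fromℕ<; fromℕ<-toℕ; toℕ<n)
open import Data.Product using (_,_; proj₁; proj₂)
open import Function using (_∘_)
open import Relation.Nullary using (yes; no; contradiction)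
open import Relation.Binary.PropositionalEquality
  using (refl; sym; trans; cong; cong₂; subst; module ≡-Reasoning)

open ≡-Reasoning

2∤1 : ¬ 2 ∣ 1
2∤1 2∣1 with ∣1⇒≡1 2∣1
... | ()

2∣2+n⇒2∣n : ∀ {n} → 2 ∣ 2 + n → 2 ∣ n
2∣2+n⇒2∣n 2∣2+n = ∣m+n∣m⇒∣n 2∣2+n ∣-refl

2∣n⇒2∣2+n : ∀ {n} → 2 ∣ n → 2 ∣ 2 + n
2∣n⇒2∣2+n = ∣m∣n⇒∣m+n ∣-refl

i+j-i≡j : ∀ i j → i +ℤ j - i ≡ j
i+j-i≡j i j = solve (i ∷ j ∷ [])

i+j≡k⇒j≡k-i : ∀ {i j k : ℤ} → i +ℤ j ≡ k → j ≡ k - i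
i+j≡k⇒j≡k-i {i} {j} {k} i+j≡k = begin
  j          ≡⟨ i+j-i≡j i j ⟨
  i +ℤ j - i ≡⟨ cong (_- i) i+j≡k ⟩
  k - i      ∎

i+k-j≡d⇒k≡d-i+j : ∀ i j {k d : ℤ} → i +ℤ k - j ≡ d → k ≡ d - i +ℤ j
i+k-j≡d⇒k≡d-i+j i j {k} {d} eq = begin
  k                   ≡⟨ solve (i ∷ j ∷ k ∷ []) ⟩
  i +ℤ k - j - i +ℤ j ≡⟨ cong (λ x → x - i +ℤ j) eq ⟩
  d - i +ℤ j          ∎

i+k-j≡0⇒k≡j-i : ∀ i j {k : ℤ} → i +ℤ k - j ≡ 0ℤ → k ≡ j - i
i+k-j≡0⇒k≡j-i i j {k} eq = begin
  k           ≡⟨ i+k-j≡d⇒k≡d-i+j i j eq ⟩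
  0ℤ - i +ℤ j ≡⟨ solve (i ∷ j ∷ []) ⟩
  j - i       ∎

previous : (ℕ → ℤ) → ℕ → ℤ
previous x zero    = 0ℤ
previous x (suc m) = x m

module _ {N : ℕ} {s : ℤ} (x : ℕ → ℤ)
         (previous+x≡s : ∀ m → m < N → previous x m +ℤ x m ≡ s) where

  private
    x₀≡s : 0 < N → x 0 ≡ s
    x₀≡s p = trans (sym (+-identityˡ (x 0))) (previous+x≡s 0 p)

    x₁≡0 : 1 < N → x 1 ≡ 0ℤ
    x₁≡0 p = begin
      x 1     ≡⟨ i+j≡k⇒j≡k-i (previous+x≡s 1 p) ⟩
      s - x 0 ≡⟨ cong (s -_) (x₀≡s (<-trans (n<1+n 0) p)) ⟩
      s - s   ≡⟨ +-inverseʳ s ⟩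
      0ℤ      ∎

    x-periodic : ∀ m → 2 + m < N → x (2 + m) ≡ x m
    x-periodic m p = begin
      x (2 + m)     ≡⟨ i+j≡k⇒j≡k-i (previous+x≡s (2 + m) p) ⟩
      s - x (1 + m) ≡⟨ i+j≡k⇒j≡k-i x+x′≡s ⟨
      x m           ∎
      where
      x+x′≡s : x (1 + m) +ℤ x m ≡ s
      x+x′≡s = trans (+-comm (x (1 + m)) (x m)) (previous+x≡s (1 + m) (<⇒≤ p))

  alternating : ∀ m → m < N → (2 ∣ suc m → x m ≡ 0ℤ) × (¬ 2 ∣ suc m → x m ≡ s)
  alternating zero          p = (λ 2∣1 → contradiction 2∣1 2∤1) , (λ _ → x₀≡s p)
  alternating (suc zero)    p = (λ _ → x₁≡0 p) , (λ 2∤2 → contradiction ∣-refl 2∤2)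
  alternating (suc (suc m)) p =
      (λ 2∣3+m → trans (x-periodic m p) (even (2∣2+n⇒2∣n 2∣3+m)))
    , (λ 2∤3+m → trans (x-periodic m p) (odd (2∤3+m ∘ 2∣n⇒2∣2+n)))
    where
    m<N : m < N
    m<N = <-trans (n<1+n m) (<⇒≤ p)
    even : 2 ∣ suc m → x m ≡ 0ℤ
    even = proj₁ (alternating m m<N)
    odd : ¬ 2 ∣ suc m → x m ≡ s
    odd = proj₂ (alternating m m<N)

pos-+₃ : ∀ a b c → + (a + b + c) ≡ + a +ℤ + b +ℤ + c
pos-+₃ a b c = trans (pos-+ (a + b) c) (cong (_+ℤ + c) (pos-+ a b))

-- The conditions at the three vertices of a column: l, r are the horizontal labels on
-- the left and right, u and d the two vertical edges.
column-defect : ∀ l₀ l₁ l₂ r₀ r₁ r₂ u d {t} →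
  l₀ + r₀ + u ≡ t → l₁ + r₁ + (u + d) ≡ t → l₂ + r₂ + d ≡ t →
  (+ l₀ +ℤ + l₂ - + l₁) +ℤ (+ r₀ +ℤ + r₂ - + r₁) ≡ + t
column-defect l₀ l₁ l₂ r₀ r₁ r₂ u d {t} row₀ row₁ row₂ = begin
  (+ l₀ +ℤ + l₂ - + l₁) +ℤ (+ r₀ +ℤ + r₂ - + r₁)
    ≡⟨ rearrange (+ l₀) (+ l₁) (+ l₂) (+ r₀) (+ r₁) (+ r₂) (+ u) (+ d) ⟩
  (+ l₀ +ℤ + r₀ +ℤ + u) +ℤ (+ l₂ +ℤ + r₂ +ℤ + d) - (+ l₁ +ℤ + r₁ +ℤ (+ u +ℤ + d))
    ≡⟨ cong₂ _-_ (cong₂ _+ℤ_ (lift l₀ r₀ u row₀) (lift l₂ r₂ d row₂)) (lift-middle row₁) ⟩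
  + t +ℤ + t - + t
    ≡⟨ i+j-i≡j (+ t) (+ t) ⟩
  + t ∎
  where
  rearrange : ∀ L₀ L₁ L₂ R₀ R₁ R₂ U D →
    (L₀ +ℤ L₂ - L₁) +ℤ (R₀ +ℤ R₂ - R₁)
      ≡ (L₀ +ℤ R₀ +ℤ U) +ℤ (L₂ +ℤ R₂ +ℤ D) - (L₁ +ℤ R₁ +ℤ (U +ℤ D))
  rearrange L₀ L₁ L₂ R₀ R₁ R₂ U D = solve (L₀ ∷ L₁ ∷ L₂ ∷ R₀ ∷ R₁ ∷ R₂ ∷ U ∷ D ∷ [])
  lift : ∀ a b c → a + b + c ≡ t → + a +ℤ + b +ℤ + c ≡ + t
  lift a b c eq = trans (sym (pos-+₃ a b c)) (cong +_ eq)
  lift-middle : l₁ + r₁ + (u + d) ≡ t → + l₁ +ℤ + r₁ +ℤ (+ u +ℤ + d) ≡ + t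
  lift-middle eq = trans (cong (_+ℤ_ (+ l₁ +ℤ + r₁)) (sym (pos-+ u d))) (lift l₁ r₁ (u + d) eq)

horAt-< : ∀ {n} j {m} (p : m < n ∸ 1) → horAt n j m ≡ hor j (fromℕ< p) ∷ []
horAt-< {n} j {m} p with m <? n ∸ 1
... | yes _ = refl
... | no m≮n∸1 = contradiction p m≮n∸1

pattern top    = f0
pattern middle = fs f0
pattern bottom = fs (fs f0)

module _ {n : ℕ} (f : Edge n → ℕ) where

  sum-map-++ : ∀ xs ys → sum (map f (xs ++ ys)) ≡ sum (map f xs) + sum (map f ys)
  sum-map-++ xs ys = trans (cong sum (map-++ f xs ys)) (sum-++ (map f xs) (map f ys))

  -- label j m is the label of the edge {(m , j) , (m+1 , j)}, and 0 if m + 1 ≥ n.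
  label : Fin 3 → ℕ → ℕ
  label j m = sum (map f (horAt n j m))

  label-hor : ∀ j (k : Fin (n ∸ 1)) → label j (toℕ k) ≡ f (hor j k)
  label-hor j k = begin
    sum (map f (horAt n j (toℕ k)))   ≡⟨ cong (sum ∘ map f) (horAt-< j (toℕ<n k)) ⟩
    f (hor j (fromℕ< (toℕ<n k))) + 0 ≡⟨ +-identityʳ _ ⟩
    f (hor j (fromℕ< (toℕ<n k)))     ≡⟨ cong (f ∘ hor j) (fromℕ<-toℕ k (toℕ<n k)) ⟩
    f (hor j k)                       ∎

  leftLabel : Fin 3 → ℕ → ℕ
  leftLabel j zero    = 0
  leftLabel j (suc m) = label j m

  vertical : Fin n → Fin 3 → ℕ
  vertical i j = sum (map f (verAt n i j))

  middle-vertical : ∀ i → vertical i top + vertical i bottom ≡ vertical i middle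
  middle-vertical i = cong (_+ vertical i bottom) (+-identityʳ (f (ver top i)))

  horizontal : ∀ m j → sum (map f (horIncident n m j)) ≡ leftLabel j m + label j m
  horizontal zero    j = refl
  horizontal (suc m) j = sum-map-++ (horAt n j m) (horAt n j (suc m))

  defect : ℕ → ℤ
  defect m = + label top m +ℤ + label bottom m - + label middle m

  previous-defect : ∀ m →
    previous defect m ≡ + leftLabel top m +ℤ + leftLabel bottom m - + leftLabel middle m
  previous-defect zero    = refl
  previous-defect (suc m) = refl

  defect-hor : ∀ k → defect (toℕ k)
    ≡ + f (hor top k) +ℤ + f (hor bottom k) - + f (hor middle k)
  defect-hor k = cong₂ (λ a+c b → a+c - + b)
    (cong₂ (λ a c → + a +ℤ + c) (label-hor top k) (label-hor bottom k))
    (label-hor middle k)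

  module _ {t : ℕ} (magic : IsMagic n f t) where

    vertex-sum : ∀ i j → leftLabel j (toℕ i) + label j (toℕ i) + vertical i j ≡ t
    vertex-sum i j = begin
      leftLabel j (toℕ i) + label j (toℕ i) + vertical i j
        ≡⟨ cong (_+ vertical i j) (horizontal (toℕ i) j) ⟨
      sum (map f (horIncident n (toℕ i) j)) + vertical i j
        ≡⟨ sum-map-++ (horIncident n (toℕ i) j) (verAt n i j) ⟨
      sum (map f (incident n i j))
        ≡⟨ magic i j ⟩
      t ∎

    column : ∀ (i : Fin n) → previous defect (toℕ i) +ℤ defect (toℕ i) ≡ + t
    column i = trans (cong (_+ℤ defect m) (previous-defect m))
      (column-defect (L top) (L middle) (L bottom) (R top) (R middle) (R bottom) (V top) (V bottom)
                     (vertex-sum i top) middle-row (vertex-sum i bottom))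
      where
      m : ℕ
      m = toℕ i
      L R : Fin 3 → ℕ
      L j = leftLabel j m
      R j = label j m
      V : Fin 3 → ℕ
      V = vertical i
      middle-row : L middle + R middle + (V top + V bottom) ≡ t
      middle-row = trans (cong (_+_ (L middle + R middle)) (middle-vertical i)) (vertex-sum i middle)

    defect-parity : ∀ m → m < n → (2 ∣ suc m → defect m ≡ 0ℤ) × (¬ 2 ∣ suc m → defect m ≡ + t)
    defect-parity = alternating defect λ m p →
      subst (λ m → previous defect m +ℤ defect m ≡ + t) (toℕ-fromℕ< p) (column (fromℕ< p))

lemma3p1 : (n t : ℕ) → 2 < n → 2 ∣ n → 0 < t →
    (f : Edge n → ℕ) → IsMagic n f t →
    (k : Fin (n ∸ 1)) →
      (2 ∣ suc (toℕ k) →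
        + f (hor (fs (fs f0)) k) ≡ + f (hor (fs f0) k) - + f (hor f0 k))
    × (¬ (2 ∣ suc (toℕ k)) →
        + f (hor (fs (fs f0)) k) ≡ (+ t - + f (hor f0 k)) +ℤ + f (hor (fs f0) k))
lemma3p1 n t _ _ _ f magic k = even , odd
  where
  a b : ℤ
  a = + f (hor top k)
  b = + f (hor middle k)
  parity : (2 ∣ suc (toℕ k) → defect f (toℕ k) ≡ 0ℤ) × (¬ 2 ∣ suc (toℕ k) → defect f (toℕ k) ≡ + t)
  parity = defect-parity f magic (toℕ k) (<-≤-trans (toℕ<n k) (m∸n≤m n 1))
  even : 2 ∣ suc (toℕ k) → + f (hor bottom k) ≡ b - a
  even 2∣k+1 = i+k-j≡0⇒k≡j-i a b (trans (sym (defect-hor f k)) (proj₁ parity 2∣k+1))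
  odd : ¬ 2 ∣ suc (toℕ k) → + f (hor bottom k) ≡ (+ t - a) +ℤ b
  odd 2∤k+1 = i+k-j≡d⇒k≡d-i+j a b (trans (sym (defect-hor f k)) (proj₂ parity 2∤k+1))
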